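{- Let $G\in\mathcal{J}$. Then (a) $\psi(G)=\psi^+(G)=\psi^-(G)$; (b) if $G$ is even-tempered and $n\in\mathbb{Z}$, then $n\ge\psi(G)$ if and only if $n\ge\operatorname{L}(G)$, and $n\le\psi(G)$ if and only if $n\le\operatorname{R}(G)$; (c) if $G$ is odd-tempered and $n\in\mathbb{Z}$, then $n\rhd\psi(G)$ if and only if $n\ge\operatorname{R}(G)$, and $n\lhd\psi(G)$ if and only if $n\le\operatorname{L}(G)$.
   Context: A well-tempered scoring game is defined recursively: an even-tempered game is either an integer or a pair $\{G^L|G^R\}$ with finite nonempty sets of odd-tempered left and right options; an odd-tempered game is a pair $\{G^L|G^R\}$ with finite nonempty sets of even-tempered options. Integers have no options. $\pi(G)=0$ for even-tempered, $1$ for odd-tempered games. Subgames: $G$ and subgames of its options. Outcomes: $\operatorname{L}(n)=\operatorname{R}(n)=n$ for integers, otherwise $\operatorname{L}(G)=\max_{G^L}\operatorname{R}(G^L)$, $\operatorname{R}(G)=\min_{G^R}\operatorname{L}(G^R)$. $\operatorname{gap}_i(G)$ ($i=0,1$) is the supremum of $\operatorname{R}(K)-\operatorname{L}(K)$ over subgames $K$ with $\pi(K)=i$ (empty supremum $-\infty$); $\mathcal{J}$ is the class of games with $\operatorname{gap}_0=0$ and $\operatorname{gap}_1\le 2$. For normal-play partizan games, $\lhd$ means "less than or confused with" and $\rhd$ means "greater than or confused with". $\{G^L_1,\dots|G^R_1,\dots\}_+$ (resp. $\{\cdots\}_-$) denotes the usual partizan game $\{G^L_1,\dots|G^R_1,\dots\}$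 unless some integer $n$ satisfies $G^L_i\lhd n\lhd G^R_j$ for all $i,j$, in which case it denotes the largest (resp. smallest) such integer. Maps to partizan games: $\psi(n)=\psi^\pm(n)=n$ for integers; $\psi(\{G^L|G^R\})=\{\psi(G^L)|\psi(G^R)\}$ and $\psi^\pm(\{G^L|G^R\})=\{\psi^\pm(G^L)|\psi^\pm(G^R)\}_\pm$. Comparisons and equalities of partizan games are of values. -}

module Defs where

open import Data.Nat using (ℕ; zero; suc)
open import Data.Integer using (ℤ; +_; -[1+_]; _-_; _⊔_; _⊓_) renaming (_≤_ to _≤ℤ_)
open import Data.Fin using (Fin; zero; suc)
open import Data.Maybe using (Maybe; just; nothing)
open import Data.Product using (Σ; _×_; _,_)
open import Data.Sum using (_⊎_)
open import Data.Unit using (⊤)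
open import Data.Empty using (⊥)
open import Relation.Nullary using (¬_)
open import Relation.Binary.PropositionalEquality using (_≡_)

-- Normal-play partizan games (game forms), options indexed by Fin

data PG : Set where
  node : (m : ℕ) → (Fin m → PG) → (n : ℕ) → (Fin n → PG) → PG

infix 4 _≤G_ _≥G_ _≈G_ _◁_ _▷_
_≤G_ : PG → PG → Set
node m L n R ≤G node m' L' n' R' =
  ((i : Fin m) → ¬ (node m' L' n' R' ≤G L i)) ×
  ((j : Fin n') → ¬ (R' j ≤G node m L n R))

_≥G_ : PG → PG → Set
G ≥G H = H ≤G G

_≈G_ : PG → PG → Set
G ≈G H = (G ≤G H) × (H ≤G G)

_◁_ : PG → PG → Set
G ◁ H = ¬ (H ≤G G)

_▷_ : PG → PG → Set
G ▷ H = ¬ (G ≤G H)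

noOpt : Fin 0 → PG
noOpt ()

zeroG : PG
zeroG = node 0 noOpt 0 noOpt

natG : ℕ → PG
natG zero    = zeroG
natG (suc k) = node 1 (λ _ → natG k) 0 noOpt

negG : ℕ → PG
negG zero    = zeroG
negG (suc k) = node 0 noOpt 1 (λ _ → negG k)

intG : ℤ → PG
intG (+ n)      = natG n
intG -[1+ n ]   = negG (suc n)

-- Well-tempered scoring games, indexed by parity (temper)

data Par : Set where
  ev od : Par

flipP : Par → Par
flipP ev = od
flipP od = ev

-- Option sets are finite and nonempty: indexed by Fin (suc k).
data WT : Par → Set where
  int  : ℤ → WT ev
  node : ∀ {p} → (nl : ℕ) → (Fin (suc nl) → WT (flipP p))
                → (nr : ℕ) → (Fin (suc nr) → WT (flipP p)) → WT p

π : ∀ {p} → WT p → Par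
π {p} _ = p

maxF : (n : ℕ) → (Fin (suc n) → ℤ) → ℤ
maxF zero    f = f zero
maxF (suc n) f = f zero ⊔ maxF n (λ i → f (suc i))

minF : (n : ℕ) → (Fin (suc n) → ℤ) → ℤ
minF zero    f = f zero
minF (suc n) f = f zero ⊓ minF n (λ i → f (suc i))

mutual
  Lo : ∀ {p} → WT p → ℤ
  Lo (int n)           = n
  Lo (node nl L nr R)  = maxF nl (λ i → Ro (L i))

  Ro : ∀ {p} → WT p → ℤ
  Ro (int n)           = n
  Ro (node nl L nr R)  = minF nr (λ j → Lo (R j))

-- ℤ ∪ {-∞}: nothing = -∞
ExtZ : Set
ExtZ = Maybe ℤ

_⊔E_ : ExtZ → ExtZ → ExtZ
nothing ⊔E y       = y
just x  ⊔E nothing = just x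
just x  ⊔E just y  = just (x ⊔ y)

_≤E_ : ExtZ → ExtZ → Set
nothing ≤E _       = ⊤
just x  ≤E nothing = ⊥
just x  ≤E just y  = x ≤ℤ y

maxE : (n : ℕ) → (Fin (suc n) → ExtZ) → ExtZ
maxE zero    f = f zero
maxE (suc n) f = f zero ⊔E maxE n (λ i → f (suc i))

own : Par → ∀ {p} → WT p → ExtZ
own ev {ev} G = just (Ro G - Lo G)
own od {od} G = just (Ro G - Lo G)
own ev {od} G = nothing
own od {ev} G = nothing

-- gap_i(G) = sup of R(K) - L(K) over subgames K of G with π(K) = i
gap : Par → ∀ {p} → WT p → ExtZ
gap i (int n)          = own i (int n)
gap i (node nl L nr R) =
  own i (node nl L nr R) ⊔E
  (maxE nl (λ a → gap i (L a)) ⊔E maxE nr (λ b → gap i (R b)))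

InJ : ∀ {p} → WT p → Set
InJ G = (gap ev G ≡ just (+ 0)) × (gap od G ≤E just (+ 2))

ψ : ∀ {p} → WT p → PG
ψ (int n)          = intG n
ψ (node nl L nr R) = node (suc nl) (λ i → ψ (L i)) (suc nr) (λ j → ψ (R j))

Fits : (m : ℕ) → (Fin m → PG) → (n : ℕ) → (Fin n → PG) → ℤ → Set
Fits m XL n XR k = ((i : Fin m) → XL i ◁ intG k) × ((j : Fin n) → intG k ◁ XR j)

data Sign : Set where
  plus minus : Sign

Extremal : Sign → (ℤ → Set) → ℤ → Set
Extremal plus  F k = (k' : ℤ) → F k' → k' ≤ℤ k
Extremal minus F k = (k' : ℤ) → F k' → k ≤ℤ k'

Simp : Sign → (m : ℕ) → (Fin m → PG) → (n : ℕ) → (Fin n → PG) → PG → Set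
Simp s m XL n XR X =
  (((k : ℤ) → ¬ Fits m XL n XR k) × (X ≡ node m XL n XR)) ⊎
  Σ ℤ (λ k → Fits m XL n XR k × Extremal s (Fits m XL n XR) k × (X ≡ intG k))

-- graph of ψ^± :  Psi s G X  means  ψ^s(G) = X  (as game forms)
data Psi (s : Sign) : ∀ {p} → WT p → PG → Set where
  int  : (n : ℤ) → Psi s (int n) (intG n)
  node : ∀ {p} {nl : ℕ} {L : Fin (suc nl) → WT (flipP p)}
           {nr : ℕ} {R : Fin (suc nr) → WT (flipP p)} {X : PG}
         (XL : Fin (suc nl) → PG) (XR : Fin (suc nr) → PG) →
         ((i : Fin (suc nl)) → Psi s (L i) (XL i)) →
         ((j : Fin (suc nr)) → Psi s (R j) (XR j)) →
         Simp s (suc nl) XL (suc nr) XR X →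
         Psi s (node nl L nr R) X

-- For each subgame K of a game in 𝒥 put ceilψ K = L(K), floorψ K = R(K) if K is even-tempered
-- and ceilψ K = L(K) + 1, floorψ K = R(K) − 1 if it is odd-tempered; the conditions gap₀ = 0
-- and gap₁ ≤ 2 say exactly that floorψ K ≤ ceilψ K everywhere. Then, by induction on K,
-- ψ K ≤ k iff ceilψ K ≤ k, and k ≤ ψ K iff k ≤ floorψ K. Indeed ψ K ≤ k iff no left option of
-- ψ K is ≥ k (the right option k + 1 of a negative k is harmless because floorψ K ≤ ceilψ K),
-- which by induction means floorψ K^L < k for all K^L, i.e. ceilψ K ≤ k, since ceilψ K − 1 is the
-- maximum of the floorψ K^L. Parts (b) and (c) are this characterisation unfolded. It also shows
-- that the integers fitting between the options of ψ K are those in [ceilψ K, floorψ K], hence at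
-- most one, and that it equals ψ K; so ψ⁺ and ψ⁻ agree with ψ.

module Submission where

open import Defs
open import Data.Integer using (ℤ) renaming (_≤_ to _≤ℤ_)
open import Data.Product using (Σ; _×_)
open import Relation.Binary.PropositionalEquality using (_≡_)
open import Function.Bundles using (_⇔_)

open import Data.Nat as ℕ using (zero; suc; z≤n; s≤s)
import Data.Nat.Properties as ℕ
open import Data.Integer as ℤ
  using (+_; -[1+_]; _<_; _-_; +≤+; -≤+; -≤-; 0ℤ; 1ℤ; -1ℤ)
import Data.Integer.Properties as ℤ
open import Data.Integer.Solver using (module +-*-Solver)
open import Data.Fin using (Fin; zero; suc)
open import Data.Product using (_,_; proj₁; proj₂)
open import Data.Product.Function.NonDependent.Propositional using (_×-⇔_)
open import Data.Sum using (inj₁; inj₂)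
open import Data.Maybe using (just; nothing)
open import Data.Unit using (tt)
open import Data.Empty using (⊥-elim)
open import Relation.Nullary using (¬_; yes; no)
open import Relation.Binary.PropositionalEquality using (refl; sym; trans; subst)
open import Function.Bundles using (mk⇔; module Equivalence)
import Function.Properties.Equivalence as ⇔
open import Function.Related.TypeIsomorphisms using (¬-cong-⇔)

open Equivalence using (to; from)

Π-cong-⇔ : {A : Set} {P Q : A → Set} → (∀ x → P x ⇔ Q x) → ((x : A) → P x) ⇔ ((x : A) → Q x)
Π-cong-⇔ P⇔Q = mk⇔ (λ p x → to (P⇔Q x) (p x)) (λ q x → from (P⇔Q x) (q x))

≤⇔≮ : ∀ {i j} → (j ≤ℤ i) ⇔ (¬ i < j)
≤⇔≮ = mk⇔ ℤ.≤⇒≯ ℤ.≮⇒≥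

<⇔≰ : ∀ {i j} → (i < j) ⇔ (¬ j ≤ℤ i)
<⇔≰ = mk⇔ ℤ.<⇒≱ ℤ.≰⇒>

suc≤⇔< : ∀ {i j} → (ℤ.suc i ≤ℤ j) ⇔ (i < j)
suc≤⇔< = mk⇔ ℤ.suc[i]≤j⇒i<j ℤ.i<j⇒suc[i]≤j

≤pred⇔< : ∀ {i j} → (i ≤ℤ ℤ.pred j) ⇔ (i < j)
≤pred⇔< = mk⇔ ℤ.i≤pred[j]⇒i<j ℤ.i<j⇒i≤pred[j]

≤⇔≰pred : ∀ {i j} → (j ≤ℤ i) ⇔ (¬ i ≤ℤ ℤ.pred j)
≤⇔≰pred = ⇔.trans ≤⇔≮ (¬-cong-⇔ (⇔.sym ≤pred⇔<))

≤⇔≱suc : ∀ {i j} → (i ≤ℤ j) ⇔ (¬ ℤ.suc j ≤ℤ i)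
≤⇔≱suc = ⇔.trans ≤⇔≮ (¬-cong-⇔ (⇔.sym suc≤⇔<))

i-j≤2⇒pred[i]≤suc[j] : ∀ i j → i - j ≤ℤ + 2 → ℤ.pred i ≤ℤ ℤ.suc j
i-j≤2⇒pred[i]≤suc[j] i j i-j≤2 =
  ℤ.i-j≤0⇒i≤j (subst (_≤ℤ 0ℤ) (sym shift) (ℤ.i≤j⇒i-j≤0 i-j≤2))
  where
  open +-*-Solver
  shift : ℤ.pred i - ℤ.suc j ≡ (i - j) - + 2
  shift = solve 2 (λ i j → (con -1ℤ :+ i) :- (con 1ℤ :+ j) := (i :- j) :- con (+ 2)) refl i j

maxF-upper : ∀ n f (i : Fin (suc n)) → f i ≤ℤ maxF n f
maxF-upper zero    f zero    = ℤ.≤-refl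
maxF-upper (suc n) f zero    = ℤ.i≤i⊔j (f zero) _
maxF-upper (suc n) f (suc i) = ℤ.i≤j⇒i≤k⊔j (f zero) (maxF-upper n (λ i → f (suc i)) i)

maxF-attained : ∀ n f → Σ (Fin (suc n)) (λ i → maxF n f ≡ f i)
maxF-attained zero    f = zero , refl
maxF-attained (suc n) f with ℤ.⊔-sel (f zero) (maxF n (λ i → f (suc i)))
... | inj₁ eq = zero , eq
... | inj₂ eq with maxF-attained n (λ i → f (suc i))
...   | i , eq′ = suc i , trans eq eq′

minF-lower : ∀ n f (i : Fin (suc n)) → minF n f ≤ℤ f i
minF-lower zero    f zero    = ℤ.≤-refl
minF-lower (suc n) f zero    = ℤ.i⊓j≤i (f zero) _
minF-lower (suc n) f (suc i) = ℤ.i≤j⇒k⊓i≤j (f zero) (minF-lower n (λ i → f (suc i)) i)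

minF-attained : ∀ n f → Σ (Fin (suc n)) (λ i → minF n f ≡ f i)
minF-attained zero    f = zero , refl
minF-attained (suc n) f with ℤ.⊓-sel (f zero) (minF n (λ i → f (suc i)))
... | inj₁ eq = zero , eq
... | inj₂ eq with minF-attained n (λ i → f (suc i))
...   | i , eq′ = suc i , trans eq eq′

maxF-downClosed⇔ : (P : ℤ → Set) → (∀ {x y} → x ≤ℤ y → P y → P x) →
                   ∀ n f → P (maxF n f) ⇔ (∀ i → P (f i))
maxF-downClosed⇔ P down n f = mk⇔
  (λ p i → down (maxF-upper n f i) p)
  (λ all → let (i , eq) = maxF-attained n f in subst P (sym eq) (all i))

minF-upClosed⇔ : (P : ℤ → Set) → (∀ {x y} → x ≤ℤ y → P x → P y) →
                 ∀ n f → P (minF n f) ⇔ (∀ i → P (f i))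
minF-upClosed⇔ P up n f = mk⇔
  (λ p i → up (minF-lower n f i) p)
  (λ all → let (i , eq) = minF-attained n f in subst P (sym eq) (all i))

≤G-trans : ∀ G H K → G ≤G H → H ≤G K → G ≤G K
≤G-trans (node _ GL _ GR) H@(node _ _ _ _) K@(node _ _ _ KR) G≤H@(G≤H₁ , _) H≤K@(_ , H≤K₂) =
  (λ i K≤GL → G≤H₁ i (≤G-trans H K (GL i) H≤K K≤GL)) ,
  (λ j KR≤G → H≤K₂ j (≤G-trans (KR j) _ H KR≤G G≤H))

≤G⇒left◁ : ∀ {m L n R} X → node m L n R ≤G X → ∀ i → L i ◁ X
≤G⇒left◁ (node _ _ _ _) = proj₁

≤G⇒◁right : ∀ X {m L n R} → X ≤G node m L n R → ∀ j → X ◁ R j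
≤G⇒◁right (node _ _ _ _) = proj₂

≤G-refl : ∀ G → G ≤G G
≤G-refl (node m L n R) =
  (λ i G≤L → ≤G⇒left◁ (L i) G≤L i (≤G-refl (L i))) ,
  (λ j R≤G → ≤G⇒◁right (R j) R≤G j (≤G-refl (R j)))

left◁node : ∀ m L n R i → L i ◁ node m L n R
left◁node m L n R i G≤L = ≤G⇒left◁ (L i) G≤L i (≤G-refl (L i))

node◁right : ∀ m L n R j → node m L n R ◁ R j
node◁right m L n R j R≤G = ≤G⇒◁right (R j) R≤G j (≤G-refl (R j))

node-mono-≤G : ∀ {m n} {XL YL : Fin m → PG} {XR YR : Fin n → PG} →
               (∀ i → XL i ≤G YL i) → (∀ j → XR j ≤G YR j) → node m XL n XR ≤G node m YL n YR
node-mono-≤G {m} {n} {XL} {YL} {XR} {YR} XL≤YL XR≤YR =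
  (λ i Y≤XL → left◁node m YL n YR i (≤G-trans _ _ _ Y≤XL (XL≤YL i))) ,
  (λ j YR≤X → node◁right m XL n XR j (≤G-trans _ _ _ (XR≤YR j) YR≤X))

node-cong-≈G : ∀ {m n} {XL YL : Fin m → PG} {XR YR : Fin n → PG} →
               (∀ i → XL i ≈G YL i) → (∀ j → XR j ≈G YR j) → node m XL n XR ≈G node m YL n YR
node-cong-≈G XL≈YL XR≈YR =
  node-mono-≤G (λ i → proj₁ (XL≈YL i)) (λ j → proj₁ (XR≈YR j)) ,
  node-mono-≤G (λ i → proj₂ (XL≈YL i)) (λ j → proj₂ (XR≈YR j))

Fits-cong : ∀ {m n} {XL YL : Fin m → PG} {XR YR : Fin n → PG} →
            (∀ i → XL i ≈G YL i) → (∀ j → XR j ≈G YR j) →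
            ∀ k → Fits m XL n XR k ⇔ Fits m YL n YR k
Fits-cong XL≈YL XR≈YR k =
  Π-cong-⇔ (λ i → ¬-cong-⇔ (mk⇔ (λ k≤XL → ≤G-trans _ _ _ k≤XL (proj₁ (XL≈YL i)))
                               (λ k≤YL → ≤G-trans _ _ _ k≤YL (proj₂ (XL≈YL i))))) ×-⇔
  Π-cong-⇔ (λ j → ¬-cong-⇔ (mk⇔ (λ XR≤k → ≤G-trans _ _ _ (proj₂ (XR≈YR j)) XR≤k)
                               (λ YR≤k → ≤G-trans _ _ _ (proj₁ (XR≈YR j)) YR≤k)))

zeroG≤natG : ∀ b → zeroG ≤G natG b
zeroG≤natG zero    = (λ ()) , (λ ())
zeroG≤natG (suc b) = (λ ()) , (λ ())

negG≤natG : ∀ a b → negG a ≤G natG b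
negG≤natG zero    b       = zeroG≤natG b
negG≤natG (suc a) zero    = (λ ()) , (λ ())
negG≤natG (suc a) (suc b) = (λ ()) , (λ ())

natG≰negG : ∀ a b → ¬ natG a ≤G negG (suc b)
natG≰negG zero    b (_ , 0◁negG) = 0◁negG zero (negG≤natG b zero)
natG≰negG (suc a) b (_ , a◁negG) = a◁negG zero (negG≤natG b (suc a))

natG-≤G⇔ : ∀ a b → (natG a ≤G natG b) ⇔ (a ℕ.≤ b)
natG-≤G⇔ zero    b       = mk⇔ (λ _ → z≤n) (λ _ → zeroG≤natG b)
natG-≤G⇔ (suc a) zero    = mk⇔ (λ (a◁0 , _) → ⊥-elim (a◁0 zero (zeroG≤natG a))) (λ ())
natG-≤G⇔ (suc a) (suc b) = mk⇔
  (λ (a◁b+1 , _) → s≤s (ℕ.≮⇒≥ (λ b<a → a◁b+1 zero (from (natG-≤G⇔ (suc b) a) b<a))))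
  (λ { (s≤s a≤b) → (λ _ b+1≤a → ℕ.≤⇒≯ a≤b (to (natG-≤G⇔ (suc b) a) b+1≤a)) , (λ ()) })

negG-≤G⇔ : ∀ a b → (negG a ≤G negG b) ⇔ (b ℕ.≤ a)
negG-≤G⇔ a       zero    = mk⇔ (λ _ → z≤n) (λ _ → negG≤natG a zero)
negG-≤G⇔ zero    (suc b) = mk⇔ (λ (_ , 0◁b) → ⊥-elim (0◁b zero (negG≤natG b zero))) (λ ())
negG-≤G⇔ (suc a) (suc b) = mk⇔
  (λ (_ , a+1◁b) → s≤s (ℕ.≮⇒≥ (λ a<b → a+1◁b zero (from (negG-≤G⇔ b (suc a)) a<b))))
  (λ { (s≤s b≤a) → (λ ()) , (λ _ b≤a+1 → ℕ.≤⇒≯ b≤a (to (negG-≤G⇔ b (suc a)) b≤a+1)) })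

intG-≤G⇔ : ∀ a b → (intG a ≤G intG b) ⇔ (a ≤ℤ b)
intG-≤G⇔ (+ a)    (+ b)    = ⇔.trans (natG-≤G⇔ a b) (mk⇔ +≤+ ℤ.drop‿+≤+)
intG-≤G⇔ (+ a)    -[1+ b ] = mk⇔ (λ a≤b → ⊥-elim (natG≰negG a b a≤b)) (λ ())
intG-≤G⇔ -[1+ a ] (+ b)    = mk⇔ (λ _ → -≤+) (λ _ → negG≤natG (suc a) b)
intG-≤G⇔ -[1+ a ] -[1+ b ] =
  ⇔.trans (negG-≤G⇔ (suc a) (suc b)) (mk⇔ (λ { (s≤s b≤a) → -≤- b≤a }) (λ { (-≤- b≤a) → s≤s b≤a }))

negG≡intG : ∀ a → negG a ≡ intG (ℤ.- + a)
negG≡intG zero    = refl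
negG≡intG (suc a) = refl

IntegerCuts : PG → ℤ → ℤ → Set
IntegerCuts X c f = ∀ k → ((X ≤G intG k) ⇔ (c ≤ℤ k)) × ((intG k ≤G X) ⇔ (k ≤ℤ f))

IntegerCuts-≈G : ∀ {X c f k} → IntegerCuts X c f → c ≤ℤ k → k ≤ℤ f → intG k ≈G X
IntegerCuts-≈G {k = k} cuts c≤k k≤f = from (proj₂ (cuts k)) k≤f , from (proj₁ (cuts k)) c≤k

-- The only options of an integer k are k - 1 (if k > 0) and k + 1 (if k < 0); f ≤ c rules
-- out that either of them interferes.
node-integerCuts : ∀ {m HL n HR} c f → f ≤ℤ c →
  (∀ k → (∀ i → HL i ◁ intG k) ⇔ (c ≤ℤ k)) →
  (∀ k → (∀ j → intG k ◁ HR j) ⇔ (k ≤ℤ f)) →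
  IntegerCuts (node m HL n HR) c f
node-integerCuts {m} {HL} {n} {HR} c f f≤c left right k =
  mk⇔ (H≤k⇒c≤k k) (c≤k⇒H≤k k) , mk⇔ (k≤H⇒k≤f k) (k≤f⇒k≤H k)
  where
  H = node m HL n HR
  H≤k⇒c≤k : ∀ k → H ≤G intG k → c ≤ℤ k
  H≤k⇒c≤k k H≤k = to (left k) (≤G⇒left◁ (intG k) H≤k)
  k≤H⇒k≤f : ∀ k → intG k ≤G H → k ≤ℤ f
  k≤H⇒k≤f k k≤H = to (right k) (≤G⇒◁right (intG k) k≤H)
  c≤k⇒H≤k : ∀ k → c ≤ℤ k → H ≤G intG k
  c≤k⇒H≤k (+ zero)  c≤k = from (left _) c≤k , (λ ())
  c≤k⇒H≤k (+ suc a) c≤k = from (left _) c≤k , (λ ())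
  c≤k⇒H≤k -[1+ a ]  c≤k = from (left _) c≤k , λ _ k+1≤H →
    -a≰-[1+a] a (ℤ.≤-trans (k≤H⇒k≤f _ (subst (_≤G H) (negG≡intG a) k+1≤H)) (ℤ.≤-trans f≤c c≤k))
    where
    -a≰-[1+a] : ∀ a → ¬ (ℤ.- + a) ≤ℤ -[1+ a ]
    -a≰-[1+a] zero    ()
    -a≰-[1+a] (suc a) (-≤- a+1≤a) = ℕ.n≮n a a+1≤a
  k≤f⇒k≤H : ∀ k → k ≤ℤ f → intG k ≤G H
  k≤f⇒k≤H (+ zero)  k≤f = (λ ()) , from (right _) k≤f
  k≤f⇒k≤H (+ suc a) k≤f = (λ _ H≤k-1 →
    ℕ.n≮n a (ℤ.drop‿+≤+ (ℤ.≤-trans k≤f (ℤ.≤-trans f≤c (H≤k⇒c≤k _ H≤k-1))))) , from (right _) k≤f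
  k≤f⇒k≤H -[1+ a ]  k≤f = (λ ()) , from (right _) k≤f

ceilψ : ∀ {p} → WT p → ℤ
ceilψ {ev} G = Lo G
ceilψ {od} G = ℤ.suc (Lo G)

floorψ : ∀ {p} → WT p → ℤ
floorψ {ev} G = Ro G
floorψ {od} G = ℤ.pred (Ro G)

ceilψ-node-≤⇔ : ∀ {p} nl (L : Fin (suc nl) → WT (flipP p)) nr R k →
                (ceilψ (node nl L nr R) ≤ℤ k) ⇔ (∀ i → ¬ k ≤ℤ floorψ (L i))
ceilψ-node-≤⇔ {ev} nl L nr R k =
  ⇔.trans (maxF-downClosed⇔ (_≤ℤ k) ℤ.≤-trans nl (λ i → Ro (L i))) (Π-cong-⇔ λ _ → ≤⇔≰pred)
ceilψ-node-≤⇔ {od} nl L nr R k =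
  ⇔.trans suc≤⇔<
    (⇔.trans (maxF-downClosed⇔ (_< k) ℤ.≤-<-trans nl (λ i → Ro (L i))) (Π-cong-⇔ λ _ → <⇔≰))

floorψ-node-≥⇔ : ∀ {p} nl L nr (R : Fin (suc nr) → WT (flipP p)) k →
                 (k ≤ℤ floorψ (node nl L nr R)) ⇔ (∀ j → ¬ ceilψ (R j) ≤ℤ k)
floorψ-node-≥⇔ {ev} nl L nr R k =
  ⇔.trans (minF-upClosed⇔ (k ≤ℤ_) (λ x≤y k≤x → ℤ.≤-trans k≤x x≤y) nr (λ j → Lo (R j)))
    (Π-cong-⇔ λ _ → ≤⇔≱suc)
floorψ-node-≥⇔ {od} nl L nr R k =
  ⇔.trans ≤pred⇔<
    (⇔.trans (minF-upClosed⇔ (k <_) (λ x≤y k<x → ℤ.<-≤-trans k<x x≤y) nr (λ j → Lo (R j)))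
      (Π-cong-⇔ λ _ → <⇔≰))

AllSubgames : (∀ {p} → WT p → Set) → ∀ {p} → WT p → Set
AllSubgames P (int n)              = P (int n)
AllSubgames P G@(node nl L nr R) =
  P G × (∀ i → AllSubgames P (L i)) × (∀ j → AllSubgames P (R j))

OrderedCuts : ∀ {p} → WT p → Set
OrderedCuts = AllSubgames (λ K → floorψ K ≤ℤ ceilψ K)

ψ-leftOptions◁⇔ : ∀ {p} nl (L : Fin (suc nl) → WT (flipP p)) nr R →
                  (∀ i → IntegerCuts (ψ (L i)) (ceilψ (L i)) (floorψ (L i))) →
                  ∀ k → (∀ i → ψ (L i) ◁ intG k) ⇔ (ceilψ (node nl L nr R) ≤ℤ k)
ψ-leftOptions◁⇔ nl L nr R cutsL k =
  ⇔.trans (Π-cong-⇔ λ i → ¬-cong-⇔ (proj₂ (cutsL i k))) (⇔.sym (ceilψ-node-≤⇔ nl L nr R k))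

ψ-rightOptions◁⇔ : ∀ {p} nl L nr (R : Fin (suc nr) → WT (flipP p)) →
                   (∀ j → IntegerCuts (ψ (R j)) (ceilψ (R j)) (floorψ (R j))) →
                   ∀ k → (∀ j → intG k ◁ ψ (R j)) ⇔ (k ≤ℤ floorψ (node nl L nr R))
ψ-rightOptions◁⇔ nl L nr R cutsR k =
  ⇔.trans (Π-cong-⇔ λ j → ¬-cong-⇔ (proj₁ (cutsR j k))) (⇔.sym (floorψ-node-≥⇔ nl L nr R k))

ψ-cuts : ∀ {p} (G : WT p) → OrderedCuts G → IntegerCuts (ψ G) (ceilψ G) (floorψ G)
ψ-cuts (int n)          _               k = intG-≤G⇔ n k , intG-≤G⇔ k n
ψ-cuts (node nl L nr R) (f≤c , oL , oR) =
  node-integerCuts _ _ f≤c (ψ-leftOptions◁⇔  nl L nr R (λ i → ψ-cuts (L i) (oL i)))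
                           (ψ-rightOptions◁⇔ nl L nr R (λ j → ψ-cuts (R j) (oR j)))

ψ-node-Fits⇔ : ∀ {p} nl (L : Fin (suc nl) → WT (flipP p)) nr R →
               (∀ i → OrderedCuts (L i)) → (∀ j → OrderedCuts (R j)) →
               ∀ k → Fits (suc nl) (λ i → ψ (L i)) (suc nr) (λ j → ψ (R j)) k
                     ⇔ ((ceilψ (node nl L nr R) ≤ℤ k) × (k ≤ℤ floorψ (node nl L nr R)))
ψ-node-Fits⇔ nl L nr R oL oR k =
  ψ-leftOptions◁⇔  nl L nr R (λ i → ψ-cuts (L i) (oL i)) k ×-⇔
  ψ-rightOptions◁⇔ nl L nr R (λ j → ψ-cuts (R j) (oR j)) k

-- Since f ≤ c at most one integer fits, so both signs pick it.
Simp-exists : ∀ s {m XL n XR} c f → f ≤ℤ c →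
              (∀ k → Fits m XL n XR k ⇔ ((c ≤ℤ k) × (k ≤ℤ f))) → Σ PG (Simp s m XL n XR)
Simp-exists s {m} {XL} {n} {XR} c f f≤c fits with c ℤ.≤? f
... | yes c≤f = intG c , inj₂ (c , from (fits c) (ℤ.≤-refl , c≤f) , extremal s , refl)
  where
  extremal : ∀ s → Extremal s (Fits m XL n XR) c
  extremal plus  k fk = ℤ.≤-trans (proj₂ (to (fits k) fk)) f≤c
  extremal minus k fk = proj₁ (to (fits k) fk)
... | no c≰f = node m XL n XR , inj₁ (no-fit , refl)
  where
  no-fit : ∀ k → ¬ Fits m XL n XR k
  no-fit k fk = let (c≤k , k≤f) = to (fits k) fk in c≰f (ℤ.≤-trans c≤k k≤f)

Simp-≈G : ∀ {s m n XL YL XR YR X c f} → Simp s m XL n XR X →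
          (∀ i → XL i ≈G YL i) → (∀ j → XR j ≈G YR j) →
          IntegerCuts (node m YL n YR) c f → (∀ k → Fits m YL n YR k → (c ≤ℤ k) × (k ≤ℤ f)) →
          X ≈G node m YL n YR
Simp-≈G (inj₁ (_ , refl))          XL≈YL XR≈YR _    _      = node-cong-≈G XL≈YL XR≈YR
Simp-≈G (inj₂ (k , fk , _ , refl)) XL≈YL XR≈YR cuts bounds =
  let (c≤k , k≤f) = bounds k (to (Fits-cong XL≈YL XR≈YR k) fk) in IntegerCuts-≈G cuts c≤k k≤f

ψ±≈ψ : ∀ {s p} {G : WT p} {X} → OrderedCuts G → Psi s G X → X ≈G ψ G
ψ±≈ψ _ (int n) = ≤G-refl _ , ≤G-refl _
ψ±≈ψ {G = node nl L nr R} o@(_ , oL , oR) (node XL XR dL dR simp) =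
  Simp-≈G simp (λ i → ψ±≈ψ (oL i) (dL i)) (λ j → ψ±≈ψ (oR j) (dR j))
          (ψ-cuts (node nl L nr R) o) (λ k → to (ψ-node-Fits⇔ nl L nr R oL oR k))

ψ±-exists : ∀ s {p} (G : WT p) → OrderedCuts G → Σ PG (Psi s G)
ψ±-exists s (int n)          _               = intG n , int n
ψ±-exists s (node nl L nr R) (f≤c , oL , oR) =
  let (X , simp) = Simp-exists s _ _ f≤c fits in X , node XL XR dL dR simp
  where
  XL : Fin (suc nl) → PG
  XL i = proj₁ (ψ±-exists s (L i) (oL i))
  dL : ∀ i → Psi s (L i) (XL i)
  dL i = proj₂ (ψ±-exists s (L i) (oL i))
  XR : Fin (suc nr) → PG
  XR j = proj₁ (ψ±-exists s (R j) (oR j))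
  dR : ∀ j → Psi s (R j) (XR j)
  dR j = proj₂ (ψ±-exists s (R j) (oR j))
  fits : ∀ k → Fits (suc nl) XL (suc nr) XR k
               ⇔ ((ceilψ (node nl L nr R) ≤ℤ k) × (k ≤ℤ floorψ (node nl L nr R)))
  fits k = ⇔.trans (Fits-cong (λ i → ψ±≈ψ (oL i) (dL i)) (λ j → ψ±≈ψ (oR j) (dR j)) k)
                   (ψ-node-Fits⇔ nl L nr R oL oR k)

⊔E-≤E⁻ : ∀ a b {x} → (a ⊔E b) ≤E just x → (a ≤E just x) × (b ≤E just x)
⊔E-≤E⁻ nothing  b        a⊔b≤x = tt , a⊔b≤x
⊔E-≤E⁻ (just a) nothing  a⊔b≤x = a⊔b≤x , tt
⊔E-≤E⁻ (just a) (just b) a⊔b≤x = ℤ.i⊔j≤k⇒i≤k a b a⊔b≤x , ℤ.i⊔j≤k⇒j≤k a b a⊔b≤x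

maxE-≤E⁻ : ∀ n f {x} → maxE n f ≤E just x → ∀ i → f i ≤E just x
maxE-≤E⁻ zero    f max≤x zero    = max≤x
maxE-≤E⁻ (suc n) f max≤x zero    = proj₁ (⊔E-≤E⁻ (f zero) _ max≤x)
maxE-≤E⁻ (suc n) f max≤x (suc i) = maxE-≤E⁻ n (λ i → f (suc i)) (proj₂ (⊔E-≤E⁻ (f zero) _ max≤x)) i

gap-≤E⇒own-≤E : ∀ i x {p} (G : WT p) → gap i G ≤E just x → AllSubgames (λ K → own i K ≤E just x) G
gap-≤E⇒own-≤E i x (int n)          gap≤x = gap≤x
gap-≤E⇒own-≤E i x (node nl L nr R) gap≤x =
  let (own≤x , options≤x) = ⊔E-≤E⁻ (own i (node nl L nr R)) _ gap≤x
      (gapL≤x , gapR≤x)   = ⊔E-≤E⁻ (maxE nl (λ a → gap i (L a))) _ options≤x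
  in own≤x ,
     (λ a → gap-≤E⇒own-≤E i x (L a) (maxE-≤E⁻ nl _ gapL≤x a)) ,
     (λ b → gap-≤E⇒own-≤E i x (R b) (maxE-≤E⁻ nr _ gapR≤x b))

AllSubgames-zipWith : ∀ {P Q S : ∀ {p} → WT p → Set} → (∀ {p} {K : WT p} → P K → Q K → S K) →
                      ∀ {p} (G : WT p) → AllSubgames P G → AllSubgames Q G → AllSubgames S G
AllSubgames-zipWith f (int n)          PG QG = f PG QG
AllSubgames-zipWith f (node nl L nr R) (PG , PL , PR) (QG , QL , QR) =
  f PG QG ,
  (λ i → AllSubgames-zipWith f (L i) (PL i) (QL i)) ,
  (λ j → AllSubgames-zipWith f (R j) (PR j) (QR j))

floorψ≤ceilψ : ∀ {p} (K : WT p) → own ev K ≤E just 0ℤ → own od K ≤E just (+ 2) → floorψ K ≤ℤ ceilψ K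
floorψ≤ceilψ {ev} K gap₀ _    = ℤ.i-j≤0⇒i≤j gap₀
floorψ≤ceilψ {od} K _    gap₁ = i-j≤2⇒pred[i]≤suc[j] (Ro K) (Lo K) gap₁

𝒥⇒OrderedCuts : ∀ {p} (G : WT p) → InJ G → OrderedCuts G
𝒥⇒OrderedCuts G (gap₀≡0 , gap₁≤2) =
  AllSubgames-zipWith (λ {_} {K} → floorψ≤ceilψ K)
    G (gap-≤E⇒own-≤E ev 0ℤ G (subst (_≤E just 0ℤ) (sym gap₀≡0) ℤ.≤-refl)) (gap-≤E⇒own-≤E od (+ 2) G gap₁≤2)

ψ-odd-cuts : (G : WT od) → OrderedCuts G → ∀ n →
             ((intG n ▷ ψ G) ⇔ (Ro G ≤ℤ n)) × ((intG n ◁ ψ G) ⇔ (n ≤ℤ Lo G))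
ψ-odd-cuts G o n =
  ⇔.trans (¬-cong-⇔ (proj₂ (ψ-cuts G o n))) (⇔.sym ≤⇔≰pred) ,
  ⇔.trans (¬-cong-⇔ (proj₁ (ψ-cuts G o n))) (⇔.sym ≤⇔≱suc)

mainTheorem17 : ∀ {p} (G : WT p) → InJ G →
    ( ((X : PG) → Psi plus G X → X ≈G ψ G)
    × ((X : PG) → Psi minus G X → X ≈G ψ G)
    × Σ PG (Psi plus G)
    × Σ PG (Psi minus G) )
    × ( p ≡ ev → (n : ℤ) →
          ((intG n ≥G ψ G) ⇔ (Lo G ≤ℤ n))
        × ((intG n ≤G ψ G) ⇔ (n ≤ℤ Ro G)) )
    × ( p ≡ od → (n : ℤ) →
          ((intG n ▷ ψ G) ⇔ (Ro G ≤ℤ n))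
        × ((intG n ◁ ψ G) ⇔ (n ≤ℤ Lo G)) )
mainTheorem17 G G∈𝒥 =
  ((λ _ → ψ±≈ψ o) , (λ _ → ψ±≈ψ o) , ψ±-exists plus G o , ψ±-exists minus G o) ,
  (λ { refl → ψ-cuts G o }) ,
  (λ { refl → ψ-odd-cuts G o })
  where
  o : OrderedCuts G
  o = 𝒥⇒OrderedCuts G G∈𝒥
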